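{- Let $i=\lambda z.z$ and $\Omega=(\lambda x.x\,x)(\lambda x.x\,x)$. Then $\mathcal{S}k.i\cong(\mathcal{S}k.i)\,\Omega$, but $\mathcal{S}k.i$ and $(\mathcal{S}k.i)\,\Omega$ are not normal-form bisimilar.
   Context: Calculus $\lambda_S$: terms $t ::= v \mid t\,t \mid \mathcal{S}k.t \mid \langle t\rangle$, values $v ::= x \mid \lambda x.t$; pure contexts $E ::= \square \mid v\,E \mid E\,t$; evaluation contexts $F ::= \square \mid v\,F \mid F\,t \mid \langle F\rangle$ (each either pure or uniquely $F[\langle E\rangle]$ with $E$ pure); contexts $C ::= \square \mid \lambda x.C \mid t\,C \mid C\,t \mid \mathcal{S}k.C \mid \langle C\rangle$. Reduction: $F[(\lambda x.t)\,v] \to F[t\{v/x\}]$; $F[\langle E[\mathcal{S}k.t]\rangle] \to F[\langle t\{\lambda x.\langle E[x]\rangle/k\}\rangle]$ ($x\notin\mathrm{fv}(E)$); $F[\langle v\rangle]\to F[v]$. Stuck terms: control-stuck $E[\mathcal{S}k.t]$ and open-stuck $F[x\,v]$; normal form: value or stuck; $t\Downarrow t'$: $t\to^*t'$, $t'$ normal form. For closed terms, $t_0\cong t_1$ iff for every closed $C$, $C[t_0]$ evaluates to a value iff $C[t_1]$ does, and $C[t_0]$ evaluates to a control-stuck term iff $C[t_1]$ does. Extensions of a relation $R$ ($x$ fresh): $E_0\,R^c\,E_1$ iff $E_0[x]\,R\,E_1[x]$; $F_0[\langle E_0\rangle]\,R^c\,F_1[\langle E_1\rangle]$ iff $\langle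 E_0[x]\rangle\,R\,\langle E_1[x]\rangle$ and $F_0[x]\,R\,F_1[x]$ (no other pairs); $v_0\,R^v\,v_1$ iff $v_0\,x\,R\,v_1\,x$; $E_0[\mathcal{S}k.t_0]\,R^{nf}\,E_1[\mathcal{S}k.t_1]$ iff $E_0\,R^c\,E_1$ and $\langle t_0\rangle\,R\,\langle t_1\rangle$; $F_0[y\,v_0]\,R^{nf}\,F_1[y\,v_1]$ iff $F_0\,R^c\,F_1$ and $v_0\,R^v\,v_1$. A normal-form bisimulation is a relation $R$ on open terms such that $t_0\,R\,t_1$ implies: if $t_0\to t_0'$ then $t_1\to^*t_1'$ with $t_0'\,R\,t_1'$; if $t_0$ is a value then $t_1\Downarrow v_1$ with $t_0\,R^v\,v_1$; if $t_0$ is stuck then $t_1\Downarrow t_1'$ with $t_0\,R^{nf}\,t_1'$; and symmetrically. Normal-form bisimilarity is the largest normal-form bisimulation. -}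

module Defs where

-- A bound variable (of λ or of 𝒮k) is index 0 in the body;
-- a "fresh variable x" is realised by weakening (shifting all free
-- indices by one) and using index 0.

open import Data.Nat using (ℕ; zero; suc; _<_)
open import Data.Product using (Σ; ∃; _×_; _,_)
open import Data.Sum using (_⊎_)
open import Data.Unit using (⊤)
open import Data.Empty using (⊥)
open import Function using (flip)
open import Level using (0ℓ)
open import Relation.Binary.PropositionalEquality using (_≡_)
open import Relation.Binary.Core using (Rel)
open import Relation.Binary.Construct.Closure.ReflexiveTransitive using (Star)

mutual
  data Val : Set where
    var : ℕ → Val
    lam : Term → Val

  data Term : Set where
    val   : Val → Term
    app   : Term → Term → Term
    shift : Term → Term     -- 𝒮k.t  (k is index 0 in the body)
    reset : Term → Term

ext : (ℕ → ℕ) → ℕ → ℕ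
ext ρ zero    = zero
ext ρ (suc n) = suc (ρ n)

mutual
  renameV : (ℕ → ℕ) → Val → Val
  renameV ρ (var x) = var (ρ x)
  renameV ρ (lam t) = lam (rename (ext ρ) t)

  rename : (ℕ → ℕ) → Term → Term
  rename ρ (val v)     = val (renameV ρ v)
  rename ρ (app t s)   = app (rename ρ t) (rename ρ s)
  rename ρ (shift t)   = shift (rename (ext ρ) t)
  rename ρ (reset t)   = reset (rename ρ t)

exts : (ℕ → Val) → ℕ → Val
exts σ zero    = var zero
exts σ (suc n) = renameV suc (σ n)

mutual
  substV : (ℕ → Val) → Val → Val
  substV σ (var x) = σ x
  substV σ (lam t) = lam (subst (exts σ) t)

  subst : (ℕ → Val) → Term → Term
  subst σ (val v)   = val (substV σ v)
  subst σ (app t s) = app (subst σ t) (subst σ s)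
  subst σ (shift t) = shift (subst (exts σ) t)
  subst σ (reset t) = reset (subst σ t)

sub0 : Val → ℕ → Val
sub0 v zero    = v
sub0 v (suc n) = var n

_[_]₀ : Term → Val → Term
t [ v ]₀ = subst (sub0 v) t

data ECtx : Set where
  hole : ECtx
  argE : Val → ECtx → ECtx
  funE : ECtx → Term → ECtx

data FCtx : Set where
  hole   : FCtx
  argF   : Val → FCtx → FCtx
  funF   : FCtx → Term → FCtx
  resetF : FCtx → FCtx

data Ctx : Set where
  hole   : Ctx
  lamC   : Ctx → Ctx
  appRC  : Term → Ctx → Ctx
  appLC  : Ctx → Term → Ctx
  shiftC : Ctx → Ctx
  resetC : Ctx → Ctx

_[_]E : ECtx → Term → Term
hole       [ t ]E = t
argE v E   [ t ]E = app (val v) (E [ t ]E)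
funE E s   [ t ]E = app (E [ t ]E) s

_[_]F : FCtx → Term → Term
hole       [ t ]F = t
argF v F   [ t ]F = app (val v) (F [ t ]F)
funF F s   [ t ]F = app (F [ t ]F) s
resetF F   [ t ]F = reset (F [ t ]F)

_[_]C : Ctx → Term → Term
hole       [ t ]C = t
lamC C     [ t ]C = val (lam (C [ t ]C))
appRC s C  [ t ]C = app s (C [ t ]C)
appLC C s  [ t ]C = app (C [ t ]C) s
shiftC C   [ t ]C = shift (C [ t ]C)
resetC C   [ t ]C = reset (C [ t ]C)

embedE : ECtx → FCtx
embedE hole       = hole
embedE (argE v E) = argF v (embedE E)
embedE (funE E s) = funF (embedE E) s

_[⟨_⟩]FE : FCtx → ECtx → FCtx
hole       [⟨ E ⟩]FE = resetF (embedE E)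
argF v F   [⟨ E ⟩]FE = argF v (F [⟨ E ⟩]FE)
funF F s   [⟨ E ⟩]FE = funF (F [⟨ E ⟩]FE) s
resetF F   [⟨ E ⟩]FE = resetF (F [⟨ E ⟩]FE)

-- weakening of contexts (makes room for a fresh variable, index 0)
wkE : ECtx → ECtx
wkE hole       = hole
wkE (argE v E) = argE (renameV suc v) (wkE E)
wkE (funE E s) = funE (wkE E) (rename suc s)

wkF : FCtx → FCtx
wkF hole       = hole
wkF (argF v F) = argF (renameV suc v) (wkF F)
wkF (funF F s) = funF (wkF F) (rename suc s)
wkF (resetF F) = resetF (wkF F)

x₀ : Term
x₀ = val (var zero)

infix 4 _⟶_ _⟶*_

data _⟶_ : Term → Term → Set where
  βv    : ∀ F t v →
          F [ app (val (lam t)) (val v) ]F ⟶ F [ t [ v ]₀ ]F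
  shiftR : ∀ F E t →
          F [ reset (E [ shift t ]E) ]F
            ⟶ F [ reset (t [ lam (reset (wkE E [ x₀ ]E)) ]₀) ]F
  resetR : ∀ F v →
          F [ reset (val v) ]F ⟶ F [ val v ]F

_⟶*_ : Term → Term → Set
_⟶*_ = Star _⟶_

IsValue : Term → Set
IsValue t = Σ Val λ v → t ≡ val v

ControlStuck : Term → Set
ControlStuck t = Σ ECtx λ E → Σ Term λ s → t ≡ E [ shift s ]E

OpenStuck : Term → Set
OpenStuck t = Σ FCtx λ F → Σ ℕ λ y → Σ Val λ v →
              t ≡ F [ app (val (var y)) (val v) ]F

Stuck : Term → Set
Stuck t = ControlStuck t ⊎ OpenStuck t

NormalForm : Term → Set
NormalForm t = IsValue t ⊎ Stuck t

infix 4 _⇓_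
_⇓_ : Term → Term → Set
t ⇓ t' = (t ⟶* t') × NormalForm t'

mutual
  ScopedV : ℕ → Val → Set
  ScopedV n (var x) = x < n
  ScopedV n (lam t) = Scoped (suc n) t

  Scoped : ℕ → Term → Set
  Scoped n (val v)   = ScopedV n v
  Scoped n (app t s) = Scoped n t × Scoped n s
  Scoped n (shift t) = Scoped (suc n) t
  Scoped n (reset t) = Scoped n t

Closed : Term → Set
Closed = Scoped zero

-- free variables of the context (not counting the hole) lie below n
ScopedC : ℕ → Ctx → Set
ScopedC n hole        = ⊤
ScopedC n (lamC C)    = ScopedC (suc n) C
ScopedC n (appRC s C) = Scoped n s × ScopedC n C
ScopedC n (appLC C s) = ScopedC n C × Scoped n s
ScopedC n (shiftC C)  = ScopedC (suc n) C
ScopedC n (resetC C)  = ScopedC n C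

ClosedCtx : Ctx → Set
ClosedCtx = ScopedC zero

EvalsToValue : Term → Set
EvalsToValue t = Σ Term λ t' → (t ⟶* t') × IsValue t'

EvalsToControlStuck : Term → Set
EvalsToControlStuck t = Σ Term λ t' → (t ⟶* t') × ControlStuck t'

_⇔_ : Set → Set → Set
A ⇔ B = (A → B) × (B → A)

infix 4 _≅_
_≅_ : Term → Term → Set
t₀ ≅ t₁ = ∀ (C : Ctx) → ClosedCtx C →
          (EvalsToValue (C [ t₀ ]C) ⇔ EvalsToValue (C [ t₁ ]C))
        × (EvalsToControlStuck (C [ t₀ ]C) ⇔ EvalsToControlStuck (C [ t₁ ]C))

ExtCE : Rel Term 0ℓ → ECtx → ECtx → Set
ExtCE R E₀ E₁ = R (wkE E₀ [ x₀ ]E) (wkE E₁ [ x₀ ]E)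

data ExtCF (R : Rel Term 0ℓ) : FCtx → FCtx → Set where
  pure  : ∀ E₀ E₁ → ExtCE R E₀ E₁ → ExtCF R (embedE E₀) (embedE E₁)
  delim : ∀ F₀ F₁ E₀ E₁ →
          R (reset (wkE E₀ [ x₀ ]E)) (reset (wkE E₁ [ x₀ ]E)) →
          R (wkF F₀ [ x₀ ]F) (wkF F₁ [ x₀ ]F) →
          ExtCF R (F₀ [⟨ E₀ ⟩]FE) (F₁ [⟨ E₁ ⟩]FE)

ExtV : Rel Term 0ℓ → Val → Val → Set
ExtV R v₀ v₁ = R (app (val (renameV suc v₀)) x₀) (app (val (renameV suc v₁)) x₀)

data ExtNF (R : Rel Term 0ℓ) : Term → Term → Set where
  control : ∀ E₀ E₁ t₀ t₁ → ExtCE R E₀ E₁ → R (reset t₀) (reset t₁) →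
            ExtNF R (E₀ [ shift t₀ ]E) (E₁ [ shift t₁ ]E)
  open-   : ∀ F₀ F₁ y v₀ v₁ → ExtCF R F₀ F₁ → ExtV R v₀ v₁ →
            ExtNF R (F₀ [ app (val (var y)) (val v₀) ]F)
                    (F₁ [ app (val (var y)) (val v₁) ]F)

Progress : Rel Term 0ℓ → Term → Term → Set
Progress R t₀ t₁ =
    (∀ t₀' → t₀ ⟶ t₀' → Σ Term λ t₁' → (t₁ ⟶* t₁') × R t₀' t₁')
  × (∀ v₀ → t₀ ≡ val v₀ → Σ Val λ v₁ → (t₁ ⇓ val v₁) × ExtV R v₀ v₁)
  × (Stuck t₀ → Σ Term λ t₁' → (t₁ ⇓ t₁') × ExtNF R t₀ t₁')

IsNFBisimulation : Rel Term 0ℓ → Set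
IsNFBisimulation R = ∀ t₀ t₁ → R t₀ t₁ →
  Progress R t₀ t₁ × Progress (flip R) t₁ t₀

-- normal-form bisimilarity: the largest normal-form bisimulation
-- (union of all normal-form bisimulations)
NFBisimilar : Term → Term → Set₁
NFBisimilar t₀ t₁ = Σ (Rel Term 0ℓ) λ R → IsNFBisimulation R × R t₀ t₁

iT : Val
iT = lam (val (var zero))

ω : Val
ω = lam (app (val (var zero)) (val (var zero)))

Ω : Term
Ω = app (val ω) (val ω)

Ski : Term
Ski = shift (val iT)

-- Let ∼ be the compatible closure of the single pair (𝒮k.i, (𝒮k.i) Ω). It relates
-- C[𝒮k.i] to C[(𝒮k.i) Ω] for every context C, and it is a lockstep bisimulation for
-- reduction: (𝒮k.i) Ω cannot reduce because its operator is control-stuck, both sides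
-- of a pair are control-stuck together, and a capture turns both into ⟨i⟩ because k does
-- not occur in i, so the extra frame □ Ω is thrown away. Hence the two terms are
-- contextually equivalent. Normal-form bisimilarity instead compares the stuck terms'
-- contexts □ and □ Ω applied to a fresh variable x: the value x would have to be
-- matched by a value of x Ω, which reduces only to itself.
module Submission where

open import Defs
open import Data.Empty using (⊥-elim)
open import Data.Nat using (ℕ; zero; suc)
open import Data.Product using (Σ; _×_; _,_; proj₁; proj₂)
open import Data.Sum using (_⊎_; inj₁; inj₂)
open import Level using (0ℓ)
open import Relation.Binary.Core using (Rel)
open import Relation.Binary.PropositionalEquality using (_≡_; refl)
open import Relation.Binary.Construct.Closure.ReflexiveTransitive using (ε; _◅_)
open import Relation.Nullary using (¬_)

infix 4 _↝_

data _↝_ : Term → Term → Set where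
  β       : ∀ t v → app (val (lam t)) (val v) ↝ t [ v ]₀
  capture : ∀ E t → reset (E [ shift t ]E) ↝ reset (t [ lam (reset (wkE E [ x₀ ]E)) ]₀)
  unwrap  : ∀ v → reset (val v) ↝ val v
  ξ-appˡ  : ∀ {t t'} s → t ↝ t' → app t s ↝ app t' s
  ξ-appʳ  : ∀ {t t'} v → t ↝ t' → app (val v) t ↝ app (val v) t'
  ξ-reset : ∀ {t t'} → t ↝ t' → reset t ↝ reset t'

↝-plugF : ∀ F {t t'} → t ↝ t' → F [ t ]F ↝ F [ t' ]F
↝-plugF hole       r = r
↝-plugF (argF v F) r = ξ-appʳ v (↝-plugF F r)
↝-plugF (funF F s) r = ξ-appˡ s (↝-plugF F r)
↝-plugF (resetF F) r = ξ-reset (↝-plugF F r)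

⟶⇒↝ : ∀ {t t'} → t ⟶ t' → t ↝ t'
⟶⇒↝ (βv F t v)     = ↝-plugF F (β t v)
⟶⇒↝ (shiftR F E t) = ↝-plugF F (capture E t)
⟶⇒↝ (resetR F v)   = ↝-plugF F (unwrap v)

⟶-appˡ : ∀ {t t'} s → t ⟶ t' → app t s ⟶ app t' s
⟶-appˡ s (βv F t v)     = βv (funF F s) t v
⟶-appˡ s (shiftR F E t) = shiftR (funF F s) E t
⟶-appˡ s (resetR F v)   = resetR (funF F s) v

⟶-appʳ : ∀ {t t'} w → t ⟶ t' → app (val w) t ⟶ app (val w) t'
⟶-appʳ w (βv F t v)     = βv (argF w F) t v
⟶-appʳ w (shiftR F E t) = shiftR (argF w F) E t
⟶-appʳ w (resetR F v)   = resetR (argF w F) v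

⟶-reset : ∀ {t t'} → t ⟶ t' → reset t ⟶ reset t'
⟶-reset (βv F t v)     = βv (resetF F) t v
⟶-reset (shiftR F E t) = shiftR (resetF F) E t
⟶-reset (resetR F v)   = resetR (resetF F) v

↝⇒⟶ : ∀ {t t'} → t ↝ t' → t ⟶ t'
↝⇒⟶ (β t v)       = βv hole t v
↝⇒⟶ (capture E t) = shiftR hole E t
↝⇒⟶ (unwrap v)    = resetR hole v
↝⇒⟶ (ξ-appˡ s r)  = ⟶-appˡ s (↝⇒⟶ r)
↝⇒⟶ (ξ-appʳ w r)  = ⟶-appʳ w (↝⇒⟶ r)
↝⇒⟶ (ξ-reset r)   = ⟶-reset (↝⇒⟶ r)

shift-irreducible : ∀ {s t} → ¬ (shift s ↝ t)
shift-irreducible ()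

infix 4 _∼ᵛ_ _∼_ _∼ᴱ_ _∼ˢ_

mutual
  data _∼ᵛ_ : Val → Val → Set where
    var : ∀ x → var x ∼ᵛ var x
    lam : ∀ {t u} → t ∼ u → lam t ∼ᵛ lam u

  data _∼_ : Term → Term → Set where
    val      : ∀ {v w} → v ∼ᵛ w → val v ∼ val w
    app      : ∀ {t t' u u'} → t ∼ t' → u ∼ u' → app t u ∼ app t' u'
    shift    : ∀ {t u} → t ∼ u → shift t ∼ shift u
    reset    : ∀ {t u} → t ∼ u → reset t ∼ reset u
    Ski∼SkiΩ : Ski ∼ app Ski Ω

mutual
  ∼ᵛ-refl : ∀ v → v ∼ᵛ v
  ∼ᵛ-refl (var x) = var x
  ∼ᵛ-refl (lam t) = lam (∼-refl t)

  ∼-refl : ∀ t → t ∼ t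
  ∼-refl (val v)   = val (∼ᵛ-refl v)
  ∼-refl (app t u) = app (∼-refl t) (∼-refl u)
  ∼-refl (shift t) = shift (∼-refl t)
  ∼-refl (reset t) = reset (∼-refl t)

mutual
  ∼ᵛ-rename : ∀ ρ {v w} → v ∼ᵛ w → renameV ρ v ∼ᵛ renameV ρ w
  ∼ᵛ-rename ρ (var x) = var (ρ x)
  ∼ᵛ-rename ρ (lam p) = lam (∼-rename (ext ρ) p)

  ∼-rename : ∀ ρ {t u} → t ∼ u → rename ρ t ∼ rename ρ u
  ∼-rename ρ (val p)   = val (∼ᵛ-rename ρ p)
  ∼-rename ρ (app p q) = app (∼-rename ρ p) (∼-rename ρ q)
  ∼-rename ρ (shift p) = shift (∼-rename (ext ρ) p)
  ∼-rename ρ (reset p) = reset (∼-rename ρ p)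
  ∼-rename ρ Ski∼SkiΩ  = Ski∼SkiΩ

_∼ˢ_ : (ℕ → Val) → (ℕ → Val) → Set
σ ∼ˢ σ' = ∀ n → σ n ∼ᵛ σ' n

∼ˢ-exts : ∀ {σ σ'} → σ ∼ˢ σ' → exts σ ∼ˢ exts σ'
∼ˢ-exts σ∼σ' zero    = var zero
∼ˢ-exts σ∼σ' (suc n) = ∼ᵛ-rename suc (σ∼σ' n)

∼ˢ-sub0 : ∀ {v w} → v ∼ᵛ w → sub0 v ∼ˢ sub0 w
∼ˢ-sub0 v∼w zero    = v∼w
∼ˢ-sub0 v∼w (suc n) = var n

mutual
  ∼ᵛ-subst : ∀ {σ σ'} → σ ∼ˢ σ' → ∀ {v w} → v ∼ᵛ w → substV σ v ∼ᵛ substV σ' w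
  ∼ᵛ-subst σ∼σ' (var x) = σ∼σ' x
  ∼ᵛ-subst σ∼σ' (lam p) = lam (∼-subst (∼ˢ-exts σ∼σ') p)

  ∼-subst : ∀ {σ σ'} → σ ∼ˢ σ' → ∀ {t u} → t ∼ u → subst σ t ∼ subst σ' u
  ∼-subst σ∼σ' (val p)   = val (∼ᵛ-subst σ∼σ' p)
  ∼-subst σ∼σ' (app p q) = app (∼-subst σ∼σ' p) (∼-subst σ∼σ' q)
  ∼-subst σ∼σ' (shift p) = shift (∼-subst (∼ˢ-exts σ∼σ') p)
  ∼-subst σ∼σ' (reset p) = reset (∼-subst σ∼σ' p)
  ∼-subst σ∼σ' Ski∼SkiΩ  = Ski∼SkiΩ

∼-[]₀ : ∀ {t u v w} → t ∼ u → v ∼ᵛ w → t [ v ]₀ ∼ u [ w ]₀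
∼-[]₀ t∼u v∼w = ∼-subst (∼ˢ-sub0 v∼w) t∼u

data _∼ᴱ_ : ECtx → ECtx → Set where
  hole : hole ∼ᴱ hole
  argE : ∀ {v w E E'} → v ∼ᵛ w → E ∼ᴱ E' → argE v E ∼ᴱ argE w E'
  funE : ∀ {E E' s s'} → E ∼ᴱ E' → s ∼ s' → funE E s ∼ᴱ funE E' s'

∼-plugE : ∀ {E E' t u} → E ∼ᴱ E' → t ∼ u → E [ t ]E ∼ E' [ u ]E
∼-plugE hole          t∼u = t∼u
∼-plugE (argE p E∼E') t∼u = app (val p) (∼-plugE E∼E' t∼u)
∼-plugE (funE E∼E' p) t∼u = app (∼-plugE E∼E' t∼u) p

∼ᴱ-wkE : ∀ {E E'} → E ∼ᴱ E' → wkE E ∼ᴱ wkE E'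
∼ᴱ-wkE hole          = hole
∼ᴱ-wkE (argE p E∼E') = argE (∼ᵛ-rename suc p) (∼ᴱ-wkE E∼E')
∼ᴱ-wkE (funE E∼E' p) = funE (∼ᴱ-wkE E∼E') (∼-rename suc p)

∼ᵛ-continuation : ∀ {E E'} → E ∼ᴱ E' →
                  lam (reset (wkE E [ x₀ ]E)) ∼ᵛ lam (reset (wkE E' [ x₀ ]E))
∼ᵛ-continuation E∼E' = lam (reset (∼-plugE (∼ᴱ-wkE E∼E') (∼-refl x₀)))

ShiftMatchʳ : ECtx → Term → Term → Set
ShiftMatchʳ E s u =
    (Σ ECtx λ E' → Σ Term λ s' → u ≡ E' [ shift s' ]E × E ∼ᴱ E' × s ∼ s')
  ⊎ (Σ ECtx λ E' → u ≡ E' [ Ski ]E × s ≡ val iT)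

∼-shiftʳ : ∀ E s {u} → E [ shift s ]E ∼ u → ShiftMatchʳ E s u
∼-shiftʳ hole s (shift p) = inj₁ (hole , _ , refl , hole , p)
∼-shiftʳ hole s Ski∼SkiΩ  = inj₂ (funE hole Ω , refl , refl)
∼-shiftʳ (argE v E) s (app (val p) q) with ∼-shiftʳ E s q
... | inj₁ (E' , s' , refl , E∼E' , s∼s') = inj₁ (argE _ E' , s' , refl , argE p E∼E' , s∼s')
... | inj₂ (E' , refl , refl)             = inj₂ (argE _ E' , refl , refl)
∼-shiftʳ (funE E r) s (app p q) with ∼-shiftʳ E s p
... | inj₁ (E' , s' , refl , E∼E' , s∼s') = inj₁ (funE E' _ , s' , refl , funE E∼E' q , s∼s')
... | inj₂ (E' , refl , refl)             = inj₂ (funE E' _ , refl , refl)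

ShiftMatchˡ : ECtx → Term → Term → Set
ShiftMatchˡ E' s' t =
    (Σ ECtx λ E → Σ Term λ s → t ≡ E [ shift s ]E × E ∼ᴱ E' × s ∼ s')
  ⊎ (Σ ECtx λ E → t ≡ E [ Ski ]E × s' ≡ val iT)

∼-shiftˡ : ∀ E' s' {t} → t ∼ E' [ shift s' ]E → ShiftMatchˡ E' s' t
∼-shiftˡ hole s' (shift p) = inj₁ (hole , _ , refl , hole , p)
∼-shiftˡ (argE w E') s' (app (val p) q) with ∼-shiftˡ E' s' q
... | inj₁ (E , s , refl , E∼E' , s∼s') = inj₁ (argE _ E , s , refl , argE p E∼E' , s∼s')
... | inj₂ (E , refl , refl)            = inj₂ (argE _ E , refl , refl)
∼-shiftˡ (funE hole r) s' Ski∼SkiΩ = inj₂ (hole , refl , refl)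
∼-shiftˡ (funE E' r) s' (app p q) with ∼-shiftˡ E' s' p
... | inj₁ (E , s , refl , E∼E' , s∼s') = inj₁ (funE E _ , s , refl , funE E∼E' q , s∼s')
... | inj₂ (E , refl , refl)            = inj₂ (funE E _ , refl , refl)

∼-simulates : ∀ {t t' u} → t ∼ u → t ↝ t' → Σ Term λ u' → u ↝ u' × t' ∼ u'
∼-simulates (app (val (lam p)) (val q)) (β _ _) = _ , β _ _ , ∼-[]₀ p q
∼-simulates (reset p) (capture E s) with ∼-shiftʳ E s p
... | inj₁ (E' , s' , refl , E∼E' , s∼s') =
  _ , capture E' s' , reset (∼-[]₀ s∼s' (∼ᵛ-continuation E∼E'))
-- k does not occur in i, so whatever context is captured is discarded.
... | inj₂ (E' , refl , refl) = _ , capture E' (val iT) , ∼-refl _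
∼-simulates (reset (val p)) (unwrap _) = _ , unwrap _ , val p
∼-simulates (app p q) (ξ-appˡ _ r) with ∼-simulates p r
... | u' , r' , p' = _ , ξ-appˡ _ r' , app p' q
∼-simulates (app (val p) q) (ξ-appʳ _ r) with ∼-simulates q r
... | u' , r' , q' = _ , ξ-appʳ _ r' , app (val p) q'
∼-simulates (reset p) (ξ-reset r) with ∼-simulates p r
... | u' , r' , p' = _ , ξ-reset r' , reset p'

∼-simulated : ∀ {t u u'} → t ∼ u → u ↝ u' → Σ Term λ t' → t ↝ t' × t' ∼ u'
∼-simulated (app (val (lam p)) (val q)) (β _ _) = _ , β _ _ , ∼-[]₀ p q
∼-simulated (reset p) (capture E' s') with ∼-shiftˡ E' s' p
... | inj₁ (E , s , refl , E∼E' , s∼s') =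
  _ , capture E s , reset (∼-[]₀ s∼s' (∼ᵛ-continuation E∼E'))
... | inj₂ (E , refl , refl) = _ , capture E (val iT) , ∼-refl _
∼-simulated (reset (val p)) (unwrap _) = _ , unwrap _ , val p
∼-simulated Ski∼SkiΩ (ξ-appˡ _ r) = ⊥-elim (shift-irreducible r)
∼-simulated (app p q) (ξ-appˡ _ r) with ∼-simulated p r
... | t' , r' , p' = _ , ξ-appˡ _ r' , app p' q
∼-simulated (app (val p) q) (ξ-appʳ _ r) with ∼-simulated q r
... | t' , r' , q' = _ , ξ-appʳ _ r' , app (val p) q'
∼-simulated (reset p) (ξ-reset r) with ∼-simulated p r
... | t' , r' , p' = _ , ξ-reset r' , reset p'

∼-simulates* : ∀ {t t' u} → t ∼ u → t ⟶* t' → Σ Term λ u' → u ⟶* u' × t' ∼ u'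
∼-simulates* t∼u ε = _ , ε , t∼u
∼-simulates* t∼u (r ◅ rs) with ∼-simulates t∼u (⟶⇒↝ r)
... | _ , r' , t₁∼u₁ with ∼-simulates* t₁∼u₁ rs
... | u' , rs' , t'∼u' = u' , ↝⇒⟶ r' ◅ rs' , t'∼u'

∼-simulated* : ∀ {t u u'} → t ∼ u → u ⟶* u' → Σ Term λ t' → t ⟶* t' × t' ∼ u'
∼-simulated* t∼u ε = _ , ε , t∼u
∼-simulated* t∼u (r ◅ rs) with ∼-simulated t∼u (⟶⇒↝ r)
... | _ , r' , t₁∼u₁ with ∼-simulated* t₁∼u₁ rs
... | t' , rs' , t'∼u' = t' , ↝⇒⟶ r' ◅ rs' , t'∼u'

∼-isValue : ∀ {t u} → t ∼ u → IsValue t → IsValue u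
∼-isValue (val _) (_ , refl) = _ , refl

∼-isValue⁻¹ : ∀ {t u} → t ∼ u → IsValue u → IsValue t
∼-isValue⁻¹ (val _) (_ , refl) = _ , refl

∼-controlStuck : ∀ {t u} → t ∼ u → ControlStuck t → ControlStuck u
∼-controlStuck t∼u (E , s , refl) with ∼-shiftʳ E s t∼u
... | inj₁ (E' , s' , refl , _) = E' , s' , refl
... | inj₂ (E' , refl , _)      = E' , val iT , refl

∼-controlStuck⁻¹ : ∀ {t u} → t ∼ u → ControlStuck u → ControlStuck t
∼-controlStuck⁻¹ t∼u (E' , s' , refl) with ∼-shiftˡ E' s' t∼u
... | inj₁ (E , s , refl , _) = E , s , refl
... | inj₂ (E , refl , _)     = E , val iT , refl

∼-evalsTo : ∀ {P : Term → Set} → (∀ {t u} → t ∼ u → P t → P u) →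
            ∀ {t u} → t ∼ u → (Σ Term λ t' → t ⟶* t' × P t') → Σ Term λ u' → u ⟶* u' × P u'
∼-evalsTo preserve t∼u (t' , rs , Pt') with ∼-simulates* t∼u rs
... | u' , rs' , t'∼u' = u' , rs' , preserve t'∼u' Pt'

∼-evalsTo⁻¹ : ∀ {P : Term → Set} → (∀ {t u} → t ∼ u → P u → P t) →
              ∀ {t u} → t ∼ u → (Σ Term λ u' → u ⟶* u' × P u') → Σ Term λ t' → t ⟶* t' × P t'
∼-evalsTo⁻¹ reflect t∼u (u' , rs , Pu') with ∼-simulated* t∼u rs
... | t' , rs' , t'∼u' = t' , rs' , reflect t'∼u' Pu'

∼-plugC : ∀ C → C [ Ski ]C ∼ C [ app Ski Ω ]C
∼-plugC hole        = Ski∼SkiΩ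
∼-plugC (lamC C)    = val (lam (∼-plugC C))
∼-plugC (appRC s C) = app (∼-refl s) (∼-plugC C)
∼-plugC (appLC C s) = app (∼-plugC C) (∼-refl s)
∼-plugC (shiftC C)  = shift (∼-plugC C)
∼-plugC (resetC C)  = reset (∼-plugC C)

Ski≅SkiΩ : Ski ≅ app Ski Ω
Ski≅SkiΩ C _ =
    (∼-evalsTo ∼-isValue C∼ , ∼-evalsTo⁻¹ ∼-isValue⁻¹ C∼)
  , (∼-evalsTo ∼-controlStuck C∼ , ∼-evalsTo⁻¹ ∼-controlStuck⁻¹ C∼)
  where C∼ = ∼-plugC C

SkiΩ-normal : ∀ {t} → app Ski Ω ⟶* t → t ≡ app Ski Ω
SkiΩ-normal ε = refl
SkiΩ-normal (r ◅ _) with ⟶⇒↝ r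
... | ξ-appˡ _ r' = ⊥-elim (shift-irreducible r')

x₀Ω-loops : ∀ {t} → app x₀ Ω ↝ t → t ≡ app x₀ Ω
x₀Ω-loops (ξ-appʳ _ (β _ _)) = refl
x₀Ω-loops (ξ-appʳ _ (ξ-appˡ _ ()))
x₀Ω-loops (ξ-appʳ _ (ξ-appʳ _ ()))
x₀Ω-loops (ξ-appˡ _ ())

x₀Ω-diverges : ∀ {v} → ¬ (app x₀ Ω ⟶* val v)
x₀Ω-diverges (r ◅ rs) with x₀Ω-loops (⟶⇒↝ r)
... | refl = x₀Ω-diverges rs

module _ {R : Rel Term 0ℓ} (isBisim : IsNFBisimulation R) where

  stuck-matched : ∀ {t u} → R t u → Stuck t → Σ Term λ u' → u ⇓ u' × ExtNF R t u'
  stuck-matched tRu = proj₂ (proj₂ (proj₁ (isBisim _ _ tRu)))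

  value-matched : ∀ {v u} → R (val v) u → Σ Val λ w → u ⟶* val w
  value-matched vRu with proj₁ (proj₂ (proj₁ (isBisim _ _ vRu))) _ refl
  ... | w , (rs , _) , _ = w , rs

-- 𝒮k.i and (𝒮k.i) Ω are control-stuck only in the contexts □ and □ Ω, and R^c relates
-- these exactly when R x (x Ω).
ExtNF-Ski-SkiΩ : ∀ {R t u} → ExtNF R t u → t ≡ Ski → u ≡ app Ski Ω → R x₀ (app x₀ Ω)
ExtNF-Ski-SkiΩ (control hole (funE hole _) _ _ x∼xΩ _) refl refl = x∼xΩ
ExtNF-Ski-SkiΩ (control hole hole _ _ _ _)                refl ()
ExtNF-Ski-SkiΩ (control hole (argE _ _) _ _ _ _)          refl ()
ExtNF-Ski-SkiΩ (control hole (funE (argE _ _) _) _ _ _ _) refl ()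
ExtNF-Ski-SkiΩ (control hole (funE (funE _ _) _) _ _ _ _) refl ()
ExtNF-Ski-SkiΩ (control (argE _ _) _ _ _ _ _)             () _
ExtNF-Ski-SkiΩ (control (funE _ _) _ _ _ _ _)             () _
ExtNF-Ski-SkiΩ (open- hole _ _ _ _ _ _)                   () _
ExtNF-Ski-SkiΩ (open- (argF _ _) _ _ _ _ _ _)             () _
ExtNF-Ski-SkiΩ (open- (funF _ _) _ _ _ _ _ _)             () _
ExtNF-Ski-SkiΩ (open- (resetF _) _ _ _ _ _ _)             () _

Ski≉SkiΩ : ¬ NFBisimilar Ski (app Ski Ω)
Ski≉SkiΩ (R , isBisim , R-Ski-SkiΩ)
  with stuck-matched isBisim R-Ski-SkiΩ (inj₁ (hole , val iT , refl))
... | _ , (SkiΩ⟶* , _) , nf with SkiΩ-normal SkiΩ⟶*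
... | refl with value-matched isBisim (ExtNF-Ski-SkiΩ nf refl refl)
... | _ , x₀Ω⟶*value = x₀Ω-diverges x₀Ω⟶*value

proposition6p13 : (Ski ≅ app Ski Ω) × ¬ NFBisimilar Ski (app Ski Ω)
proposition6p13 = Ski≅SkiΩ , Ski≉SkiΩ
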